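{- Let $R$ be an algebra over a field $\mathbb{K}$ containing the algebra of $n\times n$ matrices over $\mathbb{K}$. Then ${\sf snc}\mbox{ - }{\sf Sym}_{n,n}$ is not in ${\sf VP}$ (i.e. does not have polynomial size non-commutative arithmetic circuits over $R$) unless the Cayley determinant has polynomial size arithmetic circuits.
   Context: For non-commuting variables $x_1,\ldots,x_n$, ${\sf snc}\mbox{ - }{\sf Sym}_{n,n}(x_1,\ldots,x_n)=\sum_{\sigma\in S_n}{\rm sgn}(\sigma)\,x_{\sigma(1)}x_{\sigma(2)}\cdots x_{\sigma(n)}$. The Cayley determinant of an $n\times n$ matrix $X=(x_{i,j})$ of non-commuting variables is ${\sf C}\mbox{ - }{\sf det}(X)=\sum_{\sigma\in S_n}{\rm sgn}(\sigma)\,x_{1,\sigma(1)}\cdots x_{n,\sigma(n)}$. A non-commutative arithmetic circuit is a directed acyclic graph with inputs labeled by variables or elements of $R$ and fan-in-two $+$ and $\times$ gates (products in the order of the children); size is the number of gates. -}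

module Defs where

open import Level using (Level; _⊔_; suc)
open import Data.Nat as ℕ using (ℕ; zero; _≤_; _<_)
open import Data.Nat.Base using (_^_) renaming (_*_ to _*ℕ_; _+_ to _+ℕ_)
open import Data.Fin using (Fin; toℕ; _<?_) renaming (zero to fzero; suc to fsuc)
open import Data.Fin as F using ()
open import Data.List using (List; []; _∷_; length; map)
open import Data.List.Relation.Unary.Unique.Propositional using (Unique)
open import Data.List.Relation.Unary.Unique.DecPropositional using (unique?)
open import Data.Bool using (Bool; true; false; if_then_else_)
open import Data.Product using (Σ; ∃; ∃-syntax; _×_; _,_; proj₁; proj₂)
open import Data.Product.Properties using (≡-dec)
open import Relation.Nullary using (¬_; Dec; yes; no)
open import Relation.Nullary.Decidable using (⌊_⌋; _×-dec_)
open import Relation.Binary.Definitions using (DecidableEquality)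
open import Relation.Binary.PropositionalEquality using (_≡_)
open import Algebra.Bundles using (CommutativeRing; Ring)

record Field (c ℓ : Level) : Set (suc (c ⊔ ℓ)) where
  field
    commutativeRing : CommutativeRing c ℓ
  open CommutativeRing commutativeRing public
  field
    0≉1     : ¬ (0# ≈ 1#)
    inverse : ∀ x → ¬ (x ≈ 0#) → ∃[ y ] (x * y ≈ 1#)

-- Algebras over a field K: a (unital, associative) ring R together with
-- a unital ring homomorphism φ : K → R landing in the centre of R.
-- Scalar multiplication is c · x = φ c * x.

record Algebra {k ℓk} (K : Field k ℓk) (r ℓr : Level)
       : Set (k ⊔ ℓk ⊔ suc (r ⊔ ℓr)) where
  private module K = Field K
  field
    ring : Ring r ℓr
  open Ring ring public
  field
    φ        : K.Carrier → Carrier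
    φ-cong   : ∀ {a b} → a K.≈ b → φ a ≈ φ b
    φ-+      : ∀ a b → φ (a K.+ b) ≈ φ a + φ b
    φ-*      : ∀ a b → φ (a K.* b) ≈ φ a * φ b
    φ-1      : φ K.1# ≈ 1#
    φ-central : ∀ a x → φ a * x ≈ x * φ a

module _ {c ℓ} (R : Ring c ℓ) where
  open Ring R
  ∑ : ∀ n → (Fin n → Carrier) → Carrier
  ∑ zero    f = 0#
  ∑ (ℕ.suc n) f = f fzero + ∑ n (λ i → f (fsuc i))

module _ {k ℓk} (K : Field k ℓk) where
  private module K = Field K

  Mat : ℕ → Set k
  Mat n = Fin n → Fin n → K.Carrier

  _≈M_ : ∀ {n} → Mat n → Mat n → Set ℓk
  A ≈M B = ∀ i j → A i j K.≈ B i j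

  _+M_ : ∀ {n} → Mat n → Mat n → Mat n
  (A +M B) i j = A i j K.+ B i j

  _*M_ : ∀ {n} → Mat n → Mat n → Mat n
  _*M_ {n} A B i j = ∑ K.ring n (λ l → A i l K.* B l j)

  1M : ∀ {n} → Mat n
  1M i j with i F.≟ j
  ... | yes _ = K.1#
  ... | no  _ = K.0#

  _·M_ : ∀ {n} → K.Carrier → Mat n → Mat n
  (a ·M A) i j = a K.* A i j

  record ContainsMat {r ℓr} (R : Algebra K r ℓr) (n : ℕ)
         : Set (k ⊔ ℓk ⊔ r ⊔ ℓr) where
    private module R = Algebra R
    field
      ι        : Mat n → R.Carrier
      ι-cong   : ∀ {A B} → A ≈M B → ι A R.≈ ι B
      ι-inj    : ∀ {A B} → ι A R.≈ ι B → A ≈M B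
      ι-+      : ∀ A B → ι (A +M B) R.≈ ι A R.+ ι B
      ι-*      : ∀ A B → ι (A *M B) R.≈ ι A R.* ι B
      ι-1      : ι 1M R.≈ R.1#
      ι-scalar : ∀ a A → ι (a ·M A) R.≈ R.φ a R.* ι A

-- Non-commutative polynomials over a ring R in variables X, represented
-- by their coefficient function on words (monomials) List X.

module _ {c ℓ} (R : Ring c ℓ) where
  open Ring R

  NCPoly : ∀ {x} → Set x → Set (x ⊔ c)
  NCPoly X = List X → Carrier

  _≈P_ : ∀ {x} {X : Set x} → NCPoly X → NCPoly X → Set (x ⊔ ℓ)
  p ≈P q = ∀ w → p w ≈ q w

-- Inputs are variables or ring constants; each gate is a fan-in-two
-- + or × gate whose children are inputs or earlier gates.

data Node {x c} (X : Set x) (C : Set c) (s : ℕ) : Set (x ⊔ c) where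
  var   : X → Node X C s
  const : C → Node X C s
  gate  : Fin s → Node X C s

data Gate {x c} (X : Set x) (C : Set c) (s : ℕ) : Set (x ⊔ c) where
  add : Node X C s → Node X C s → Gate X C s
  mul : Node X C s → Node X C s → Gate X C s

data Gates {x c} (X : Set x) (C : Set c) : ℕ → Set (x ⊔ c) where
  []  : Gates X C zero
  _▷_ : ∀ {s} → Gates X C s → Gate X C s → Gates X C (ℕ.suc s)

record Circuit {x c} (X : Set x) (C : Set c) : Set (x ⊔ c) where
  constructor circuit
  field
    size   : ℕ
    gates  : Gates X C size
    output : Node X C size
open Circuit public

splits : ∀ {x} {X : Set x} → List X → List (List X × List X)
splits []       = ([] , []) ∷ []
splits (a ∷ w)  = ([] , a ∷ w) ∷ map (λ { (u , v) → (a ∷ u , v) }) (splits w)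

module Semantics {c ℓ x} (R : Ring c ℓ) {X : Set x} (_≟X_ : DecidableEquality X) where
  open Ring R

  sumL : List Carrier → Carrier
  sumL []       = 0#
  sumL (a ∷ as) = a + sumL as

  varP : X → NCPoly R X
  varP y (z ∷ []) with y ≟X z
  ... | yes _ = 1#
  ... | no  _ = 0#
  varP y _ = 0#

  constP : Carrier → NCPoly R X
  constP a [] = a
  constP a (_ ∷ _) = 0#

  _+P_ : NCPoly R X → NCPoly R X → NCPoly R X
  (p +P q) w = p w + q w

  _*P_ : NCPoly R X → NCPoly R X → NCPoly R X
  (p *P q) w = sumL (map (λ { (u , v) → p u * q v }) (splits w))

  gatePolys : ∀ {s} → Gates X Carrier s → Fin s → NCPoly R X
  nodePoly  : ∀ {s} → Gates X Carrier s → Node X Carrier s → NCPoly R X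

  nodePoly gs (var y)   = varP y
  nodePoly gs (const a) = constP a
  nodePoly gs (gate i)  = gatePolys gs i

  gatePolys (gs ▷ add a b) fzero    = nodePoly gs a +P nodePoly gs b
  gatePolys (gs ▷ mul a b) fzero    = nodePoly gs a *P nodePoly gs b
  gatePolys (gs ▷ g)       (fsuc i) = gatePolys gs i

  ⟦_⟧ : Circuit X Carrier → NCPoly R X
  ⟦ C ⟧ = nodePoly (gates C) (output C)

-- Signs of permutations: a word w over Fin n is (the one-line notation
-- of) a permutation iff it has length n and no repeated entries; its
-- sign is (-1)^(number of inversions).

inversions : ∀ {n} → List (Fin n) → ℕ
inversions []      = 0
inversions (a ∷ w) = countGreater w +ℕ inversions w
  where
  countGreater : List _ → ℕ
  countGreater [] = 0
  countGreater (b ∷ v) = (if ⌊ b <? a ⌋ then 1 else 0) +ℕ countGreater v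

isPerm? : ∀ n (w : List (Fin n)) → Dec ((length w ≡ n) × Unique w)
isPerm? n w = (length w ℕ.≟ n) ×-dec unique? F._≟_ w

module Polys {c ℓ} (R : Ring c ℓ) where
  open Ring R

  signR : ℕ → Carrier
  signR zero = 1#
  signR (ℕ.suc zero) = - 1#
  signR (ℕ.suc (ℕ.suc m)) = signR m

  -- snc-Sym_{n,n}(x_1..x_n) = Σ_{σ ∈ S_n} sgn(σ) x_{σ(1)} ⋯ x_{σ(n)}
  sncSym : ∀ n → NCPoly R (Fin n)
  sncSym n w with isPerm? n w
  ... | yes _ = signR (inversions w)
  ... | no  _ = 0#

  -- C-det(X) = Σ_{σ ∈ S_n} sgn(σ) x_{1,σ(1)} ⋯ x_{n,σ(n)}
  -- the word must be x_{1,j_1} x_{2,j_2} ⋯ x_{n,j_n} with (j_1..j_n) a permutation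
  rowsInOrder : ∀ {n} → ℕ → List (Fin n × Fin n) → Bool
  rowsInOrder k [] = true
  rowsInOrder k ((i , _) ∷ w) = if ⌊ toℕ i ℕ.≟ k ⌋ then rowsInOrder (ℕ.suc k) w else false

  cdet : ∀ n → NCPoly R (Fin n × Fin n)
  cdet n w with rowsInOrder 0 w | isPerm? n (map proj₂ w)
  ... | true  | yes _ = signR (inversions (map proj₂ w))
  ... | true  | no  _ = 0#
  ... | false | _     = 0#

HasPolySizeCircuits : ∀ {c ℓ x} (R : ℕ → Ring c ℓ) (X : ℕ → Set x)
  (dec : ∀ n → DecidableEquality (X n)) (p : ∀ n → NCPoly (R n) (X n))
  → Set (c ⊔ ℓ ⊔ x)
HasPolySizeCircuits R X dec p =
  ∃[ a ] ∃[ e ] ∀ n → ∃[ C ]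
    ((size C ≤ a *ℕ n ^ e +ℕ a) × _≈P_ (R n) (Semantics.⟦_⟧ (R n) (dec n) C) (p n))

-- The matrix units e i j of M_n(K) ⊆ R split every a ∈ R into coordinates
-- coord p q a lying in the centraliser C of the units (R ≅ M_n(C)).  Given a
-- circuit for snc-Sym over the variables x_j, substitute x_j ↦ Σ_i d i · y_ij
-- with d i = e i (i+1 mod n), simulating every gate by the n × n blocks of its
-- polynomial: blocks of sums and products are sums and matrix products of
-- blocks, so each gate costs O(n) gates per block.  In the (0, 0) block the
-- coefficient of a word w in the y_ij is coord 0 0 (snc-Sym(columns w)) times
-- the weight d i₁ ⋯ d iₖ of its rows; conjugating by e k 0, e 0 k and summing
-- over k keeps exactly the words whose rows are 0, …, n-1 in order, which is
-- C-det.
module Submission where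

open import Defs
open import Level using (_⊔_)
open import Data.Nat as ℕ using (ℕ; zero; suc; z≤n; s≤s; _^_) renaming (_+_ to _+ℕ_; _*_ to _*ℕ_; _≤_ to _≤ℕ_)
import Data.Nat.Properties as ℕP
open import Data.Nat.Solver using (module +-*-Solver)
import Data.List.Relation.Unary.All.Properties as AllP
open import Data.Fin using (Fin; toℕ; fromℕ<; combine; remQuot) renaming (zero to fzero; suc to fsuc)
open import Data.Fin.Properties using (_≟_; suc-injective; toℕ-injective; toℕ-fromℕ<; remQuot-combine)
open import Data.Nat.DivMod using (_%_; m%n<n; n%n≡0; m<n⇒m%n≡m)
open import Data.List using (List; []; _∷_; map; length)
open import Data.Bool using (true; false; if_then_else_)
open import Data.List.Properties using (map-∘; length-map)
open import Data.List.Relation.Unary.All as All using (All; []; _∷_)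
open import Data.Product using (Σ; _×_; _,_; proj₁; proj₂)
open import Data.Product.Properties using (≡-dec)
open import Relation.Nullary using (¬_; yes; no; contradiction)
open import Relation.Binary.Definitions using (DecidableEquality)
open import Relation.Binary.PropositionalEquality as ≡ using (_≡_)
open import Algebra.Bundles using (Ring)
import Algebra.Properties.Group as GroupProperties
import Algebra.Properties.Semiring.Sum as SemiringSum
import Relation.Binary.Reasoning.Setoid as SetoidReasoning

module Sums {c ℓ} (R : Ring c ℓ) where
  open Ring R
  open SemiringSum semiring public
    using (sum; sum-syntax; sum-cong-≋; ∑-distrib-+; ∑-comm; *-distribˡ-sum; *-distribʳ-sum)

  ∑≡sum : ∀ n (f : Fin n → Carrier) → ∑ R n f ≡ sum f
  ∑≡sum zero    f = ≡.refl
  ∑≡sum (suc n) f = ≡.cong (f fzero +_) (∑≡sum n (λ i → f (fsuc i)))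

  sum-zero : ∀ n {f : Fin n → Carrier} → (∀ i → f i ≈ 0#) → ∑[ i < n ] f i ≈ 0#
  sum-zero zero    f≈0 = refl
  sum-zero (suc n) f≈0 =
    trans (+-cong (f≈0 fzero) (sum-zero n (λ i → f≈0 (fsuc i)))) (+-identityˡ 0#)

  sum-δ : ∀ n (f : Fin n → Carrier) k → (∀ i → ¬ i ≡ k → f i ≈ 0#) → ∑[ i < n ] f i ≈ f k
  sum-δ (suc n) f fzero    f≈0 =
    trans (+-congˡ (sum-zero n (λ i → f≈0 (fsuc i) (λ ())))) (+-identityʳ _)
  sum-δ (suc n) f (fsuc k) f≈0 =
    trans (+-congʳ (f≈0 fzero (λ ())))
      (trans (+-identityˡ _)
        (sum-δ n (λ i → f (fsuc i)) k (λ i i≢k → f≈0 (fsuc i) (λ eq → i≢k (suc-injective eq)))))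

  private module G = GroupProperties +-group

  idempotent⇒0 : ∀ a → a + a ≈ a → a ≈ 0#
  idempotent⇒0 a = G.identityˡ-unique a a

  module Additive (h : Carrier → Carrier) (h-cong : ∀ {a b} → a ≈ b → h a ≈ h b)
                  (h-+ : ∀ a b → h (a + b) ≈ h a + h b) where
    h-0 : h 0# ≈ 0#
    h-0 = idempotent⇒0 (h 0#) (trans (sym (h-+ 0# 0#)) (h-cong (+-identityˡ 0#)))

    h-neg : ∀ a → h (- a) ≈ - h a
    h-neg a = G.inverseˡ-unique (h (- a)) (h a)
      (trans (sym (h-+ (- a) a)) (trans (h-cong (-‿inverseˡ a)) h-0))

module Poly {c ℓ} (R : Ring c ℓ) {x} {X : Set x} (_≟X_ : DecidableEquality X) where
  open Ring R
  open Sums R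
  open Semantics R _≟X_

  infix 4 _≋_
  _≋_ : NCPoly R X → NCPoly R X → Set (x ⊔ ℓ)
  _≋_ = _≈P_ R

  ≋-reflexive : ∀ {p q : NCPoly R X} → p ≡ q → p ≋ q
  ≋-reflexive ≡.refl w = refl

  ≋-trans : ∀ {p q r : NCPoly R X} → p ≋ q → q ≋ r → p ≋ r
  ≋-trans p≋q q≋r w = trans (p≋q w) (q≋r w)

  sumL-cong : ∀ {a} {A : Set a} (l : List A) {f g : A → Carrier} →
              (∀ y → f y ≈ g y) → sumL (map f l) ≈ sumL (map g l)
  sumL-cong []      f≈g = refl
  sumL-cong (y ∷ l) f≈g = +-cong (f≈g y) (sumL-cong l f≈g)

  sumL-zero : ∀ {a} {A : Set a} (l : List A) {f : A → Carrier} →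
              (∀ y → f y ≈ 0#) → sumL (map f l) ≈ 0#
  sumL-zero []      f≈0 = refl
  sumL-zero (y ∷ l) f≈0 = trans (+-cong (f≈0 y) (sumL-zero l f≈0)) (+-identityˡ 0#)

  sum-sumL : ∀ {a} {A : Set a} n (l : List A) (f : Fin n → A → Carrier) →
             ∑[ i < n ] sumL (map (f i) l) ≈ sumL (map (λ y → ∑[ i < n ] f i y) l)
  sum-sumL n []      f = sum-zero n (λ _ → refl)
  sum-sumL n (y ∷ l) f = trans (∑-distrib-+ {n} _ _) (+-congˡ (sum-sumL n l f))

  sumL-cong-All : ∀ {a} {A : Set a} {l : List A} {f g : A → Carrier} →
                  All (λ y → f y ≈ g y) l → sumL (map f l) ≈ sumL (map g l)
  sumL-cong-All []           = refl
  sumL-cong-All (f≈g ∷ rest) = +-cong f≈g (sumL-cong-All rest)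

  sumL-*ʳ : ∀ {a} {A : Set a} (l : List A) (f : A → Carrier) z →
            sumL (map f l) * z ≈ sumL (map (λ y → f y * z) l)
  sumL-*ʳ []      f z = zeroˡ z
  sumL-*ʳ (y ∷ l) f z = trans (distribʳ z _ _) (+-congˡ (sumL-*ʳ l f z))

  additive-sumL : (h : Carrier → Carrier) → (∀ {a b} → a ≈ b → h a ≈ h b) →
                  (h-+ : ∀ a b → h (a + b) ≈ h a + h b) →
                  ∀ {a} {A : Set a} (l : List A) (f : A → Carrier) →
                  h (sumL (map f l)) ≈ sumL (map (λ y → h (f y)) l)
  additive-sumL h h-cong h-+ []      f = Additive.h-0 h h-cong h-+
  additive-sumL h h-cong h-+ (y ∷ l) f =
    trans (h-+ _ _) (+-congˡ (additive-sumL h h-cong h-+ l f))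

  after : X → NCPoly R X → NCPoly R X
  after y p u = p (y ∷ u)

  *P-[] : ∀ p q → (p *P q) [] ≈ p [] * q []
  *P-[] p q = +-identityʳ _

  *P-∷ : ∀ p q y w → (p *P q) (y ∷ w) ≈ p [] * q (y ∷ w) + (after y p *P q) w
  *P-∷ p q y w = +-congˡ (reflexive (≡.cong sumL (≡.sym (map-∘ (splits w)))))

  *P-cong : ∀ {p p′ q q′} → p ≋ p′ → q ≋ q′ → (p *P q) ≋ (p′ *P q′)
  *P-cong p≋p′ q≋q′ w = sumL-cong (splits w) (λ (u , v) → *-cong (p≋p′ u) (q≋q′ v))

  *P-zeroˡ : ∀ p q → (∀ u → p u ≈ 0#) → ∀ w → (p *P q) w ≈ 0#
  *P-zeroˡ p q p≈0 w = sumL-zero (splits w) (λ (u , v) → trans (*-congʳ (p≈0 u)) (zeroˡ _))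

  constP-*P : ∀ a q w → (constP a *P q) w ≈ a * q w
  constP-*P a q []      = *P-[] (constP a) q
  constP-*P a q (y ∷ w) = trans (*P-∷ (constP a) q y w)
    (trans (+-congˡ (*P-zeroˡ _ q (λ u → refl) w)) (+-identityʳ _))

  *P-constP : ∀ p a w → (p *P constP a) w ≈ p w * a
  *P-constP p a []      = *P-[] p (constP a)
  *P-constP p a (y ∷ w) = trans (*P-∷ p (constP a) y w)
    (trans (+-cong (zeroʳ _) (*P-constP (after y p) a w)) (+-identityˡ _))

  constP-0 : ∀ w → constP 0# w ≈ 0#
  constP-0 []      = refl
  constP-0 (_ ∷ _) = refl

  varP-self : ∀ y → varP y (y ∷ []) ≈ 1#
  varP-self y with y ≟X y
  ... | yes _  = refl
  ... | no y≢y = contradiction ≡.refl y≢y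

  varP-other : ∀ y z → ¬ y ≡ z → varP y (z ∷ []) ≈ 0#
  varP-other y z y≢z with y ≟X z
  ... | yes y≡z = contradiction y≡z y≢z
  ... | no _    = refl

-- The embedding ι : M_n(K) → A provides elements
-- e i j = ι(E_ij) with e i j · e k l = δ_jk e i l and ∑ e i i = 1.  Every
-- a ∈ A then has coordinates coord p q a = ∑_k e k p · a · e q k, which
-- commute with all matrix units, are additive, and multiply like the
-- entries of a matrix product (this is the decomposition A ≅ M_n(C) with
-- C the centraliser of the matrix units).
module MatrixUnits {c₁ ℓ₁ c₂ ℓ₂} (K : Field c₁ ℓ₁) (A : Algebra K c₂ ℓ₂) (n : ℕ)
                   (M : ContainsMat K A n) where
  private
    module K = Field K
    module KS = Sums K.ring
  open Algebra A
  open Sums ring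
  open ContainsMat M

  δ : Fin n → Fin n → K.Carrier
  δ = 1M K

  δ-self : ∀ a → δ a a K.≈ K.1#
  δ-self a with a ≟ a
  ... | yes _  = K.refl
  ... | no a≢a = contradiction ≡.refl a≢a

  δ-other : ∀ a b → ¬ a ≡ b → δ a b K.≈ K.0#
  δ-other a b a≢b with a ≟ b
  ... | yes a≡b = contradiction a≡b a≢b
  ... | no _    = K.refl

  δ-sym : ∀ a b → δ a b K.≈ δ b a
  δ-sym a b with a ≟ b
  ... | yes ≡.refl = K.sym (δ-self a)
  ... | no a≢b     = K.sym (δ-other b a (λ b≡a → a≢b (≡.sym b≡a)))

  φ-0 : φ K.0# ≈ 0#
  φ-0 = idempotent⇒0 _ (trans (sym (φ-+ _ _)) (φ-cong (K.+-identityˡ K.0#)))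

  E : Fin n → Fin n → Mat K n
  E i j a b = δ a i K.* δ b j

  e : Fin n → Fin n → Carrier
  e i j = ι (E i j)

  E-mul : ∀ i j k l → _≈M_ K (_*M_ K (E i j) (E k l)) (_·M_ K (δ j k) (E i l))
  E-mul i j k l a b = begin
    ∑ K.ring n (λ r → E i j a r K.* E k l r b)  ≡⟨ KS.∑≡sum n _ ⟩
    KS.sum (λ r → E i j a r K.* E k l r b)      ≈⟨ KS.sum-δ n _ j off-j ⟩
    (δ a i K.* δ j j) K.* (δ j k K.* δ b l)     ≈⟨ K.*-congʳ (K.trans (K.*-congˡ (δ-self j)) (K.*-identityʳ _)) ⟩
    δ a i K.* (δ j k K.* δ b l)                 ≈⟨ K.sym (K.*-assoc _ _ _) ⟩
    (δ a i K.* δ j k) K.* δ b l                 ≈⟨ K.*-congʳ (K.*-comm _ _) ⟩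
    (δ j k K.* δ a i) K.* δ b l                 ≈⟨ K.*-assoc _ _ _ ⟩
    δ j k K.* (δ a i K.* δ b l)                 ∎
    where
    open SetoidReasoning K.setoid
    off-j : ∀ r → ¬ r ≡ j → E i j a r K.* E k l r b K.≈ K.0#
    off-j r r≢j = K.trans (K.*-congʳ (K.trans (K.*-congˡ (δ-other r j r≢j)) (K.zeroʳ _))) (K.zeroˡ _)

  e-mul : ∀ i j k l → e i j * e k l ≈ φ (δ j k) * e i l
  e-mul i j k l = trans (sym (ι-* _ _)) (trans (ι-cong (E-mul i j k l)) (ι-scalar _ _))

  e-mul-match : ∀ i j l → e i j * e j l ≈ e i l
  e-mul-match i j l =
    trans (e-mul i j j l) (trans (*-congʳ (trans (φ-cong (δ-self j)) φ-1)) (*-identityˡ _))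

  e-mul-mismatch : ∀ i j k l → ¬ j ≡ k → e i j * e k l ≈ 0#
  e-mul-mismatch i j k l j≢k =
    trans (e-mul i j k l) (trans (*-congʳ (trans (φ-cong (δ-other j k j≢k)) φ-0)) (zeroˡ _))

  0M : Mat K n
  0M _ _ = K.0#

  ∑M : ∀ m → (Fin m → Mat K n) → Mat K n
  ∑M zero    F = 0M
  ∑M (suc m) F = _+M_ K (F fzero) (∑M m (λ i → F (fsuc i)))

  ι-∑M : ∀ m F → ι (∑M m F) ≈ ∑[ i < m ] ι (F i)
  ι-∑M zero    F = idempotent⇒0 _ (trans (sym (ι-+ 0M 0M)) (ι-cong (λ _ _ → K.+-identityˡ K.0#)))
  ι-∑M (suc m) F = trans (ι-+ _ _) (+-congˡ (ι-∑M m _))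

  ∑M-entry : ∀ m F a b → ∑M m F a b K.≈ KS.sum (λ i → F i a b)
  ∑M-entry zero    F a b = K.refl
  ∑M-entry (suc m) F a b = K.+-congˡ (∑M-entry m _ a b)

  e-complete : ∑[ i < n ] e i i ≈ 1#
  e-complete = trans (sym (ι-∑M n _)) (trans (ι-cong diagonal) ι-1)
    where
    diagonal : _≈M_ K (∑M n (λ i → E i i)) (1M K)
    diagonal a b = K.trans (∑M-entry n _ a b)
      (K.trans (KS.sum-δ n _ a (λ i i≢a → K.trans (K.*-congʳ (δ-other a i (λ a≡i → i≢a (≡.sym a≡i))))
                                                   (K.zeroˡ _)))
        (K.trans (K.*-congʳ (δ-self a)) (K.trans (K.*-identityˡ _) (δ-sym b a))))

  open SetoidReasoning setoid

  coord : Fin n → Fin n → Carrier → Carrier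
  coord p q a = ∑[ k < n ] ((e k p * a) * e q k)

  coord-cong : ∀ p q {a b} → a ≈ b → coord p q a ≈ coord p q b
  coord-cong p q a≈b = sum-cong-≋ {n} (λ k → *-congʳ (*-congˡ a≈b))

  coord-+ : ∀ p q a b → coord p q (a + b) ≈ coord p q a + coord p q b
  coord-+ p q a b =
    trans (sum-cong-≋ {n} (λ k → trans (*-congʳ (distribˡ _ _ _)) (distribʳ _ _ _))) (∑-distrib-+ {n} _ _)

  module Coord (p q : Fin n) = Additive (coord p q) (coord-cong p q) (coord-+ p q)

  coord-1-diagonal : ∀ p → coord p p 1# ≈ 1#
  coord-1-diagonal p =
    trans (sum-cong-≋ {n} (λ k → trans (*-congʳ (*-identityʳ _)) (e-mul-match k p k))) e-complete

  coord-1-offdiagonal : ∀ p q → ¬ p ≡ q → coord p q 1# ≈ 0#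
  coord-1-offdiagonal p q p≢q =
    sum-zero n (λ k → trans (*-congʳ (*-identityʳ _)) (e-mul-mismatch k p q k p≢q))

  private
    reassoc : ∀ a b c d → a * ((b * c) * d) ≈ ((a * b) * c) * d
    reassoc a b c d = trans (sym (*-assoc _ _ _)) (*-congʳ (sym (*-assoc _ _ _)))

  e-*-coord : ∀ i j p q a → e i j * coord p q a ≈ (e i p * a) * e q j
  e-*-coord i j p q a = trans (*-distribˡ-sum {n} _ _)
    (trans (sum-δ n _ j (λ k k≢j → trans (reassoc _ _ _ _)
             (trans (*-congʳ (*-congʳ (e-mul-mismatch i j k p (λ j≡k → k≢j (≡.sym j≡k)))))
               (trans (*-congʳ (zeroˡ _)) (zeroˡ _)))))
      (trans (reassoc _ _ _ _) (*-congʳ (*-congʳ (e-mul-match i j p)))))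

  coord-*-e : ∀ i j p q a → coord p q a * e i j ≈ (e i p * a) * e q j
  coord-*-e i j p q a = trans (*-distribʳ-sum {n} _ _)
    (trans (sum-δ n _ i (λ k k≢i → trans (*-assoc _ _ _) (trans (*-congˡ (e-mul-mismatch q k i j k≢i)) (zeroʳ _))))
      (trans (*-assoc _ _ _) (*-congˡ (e-mul-match q i j))))

  coord-central : ∀ p q a i j → coord p q a * e i j ≈ e i j * coord p q a
  coord-central p q a i j = trans (coord-*-e i j p q a) (sym (e-*-coord i j p q a))

  coord-* : ∀ p q a b → ∑[ r < n ] (coord p r a * coord r q b) ≈ coord p q (a * b)
  coord-* p q a b = begin
    ∑[ r < n ] (coord p r a * coord r q b)
      ≈⟨ sum-cong-≋ {n} (λ r → trans (*-distribʳ-sum {n} _ _)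
           (sum-cong-≋ {n} (λ k → trans (*-assoc _ _ _) (*-congˡ (e-*-coord r k r q b))))) ⟩
    ∑[ r < n ] ∑[ k < n ] ((e k p * a) * ((e r r * b) * e q k))
      ≈⟨ ∑-comm {n} {n} _ ⟩
    ∑[ k < n ] ∑[ r < n ] ((e k p * a) * ((e r r * b) * e q k))
      ≈⟨ sum-cong-≋ insert-unit ⟩
    coord p q (a * b) ∎
    where
    insert-unit : ∀ k → ∑[ r < n ] ((e k p * a) * ((e r r * b) * e q k)) ≈ (e k p * (a * b)) * e q k
    insert-unit k = begin
      ∑[ r < n ] ((e k p * a) * ((e r r * b) * e q k))
        ≈⟨ sym (*-distribˡ-sum {n} _ _) ⟩
      (e k p * a) * ∑[ r < n ] ((e r r * b) * e q k)
        ≈⟨ *-congˡ (sym (*-distribʳ-sum {n} _ _)) ⟩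
      (e k p * a) * ((∑[ r < n ] (e r r * b)) * e q k)
        ≈⟨ *-congˡ (*-congʳ (trans (sym (*-distribʳ-sum {n} _ _)) (trans (*-congʳ e-complete) (*-identityˡ b)))) ⟩
      (e k p * a) * (b * e q k)
        ≈⟨ sym (*-assoc _ _ _) ⟩
      ((e k p * a) * b) * e q k
        ≈⟨ *-congʳ (*-assoc _ _ _) ⟩
      (e k p * (a * b)) * e q k ∎

module Builder {c ℓ} (R : Ring c ℓ) {y} {Y : Set y} (_≟Y_ : DecidableEquality Y) where
  open Ring R
  open Sums R
  open Poly R _≟Y_
  open Semantics R _≟Y_

  G : ℕ → Set (y ⊔ c)
  G = Gates Y Carrier

  N : ℕ → Set (y ⊔ c)
  N = Node Y Carrier

  data _≼_ : ∀ {s t} → G s → G t → Set (y ⊔ c) where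
    ≼-refl : ∀ {s} {gs : G s} → gs ≼ gs
    ≼-step : ∀ {s t} {gs : G s} {hs : G t} {g} → gs ≼ hs → gs ≼ (hs ▷ g)

  ≼-trans : ∀ {s t u} {gs : G s} {hs : G t} {ks : G u} → gs ≼ hs → hs ≼ ks → gs ≼ ks
  ≼-trans gs≼hs ≼-refl         = gs≼hs
  ≼-trans gs≼hs (≼-step hs≼ks) = ≼-step (≼-trans gs≼hs hs≼ks)

  weaken₁ : ∀ {s} → N s → N (suc s)
  weaken₁ (var v)   = var v
  weaken₁ (const a) = const a
  weaken₁ (gate i)  = gate (fsuc i)

  weaken₁-sem : ∀ {s} (gs : G s) g (nd : N s) → nodePoly (gs ▷ g) (weaken₁ nd) ≡ nodePoly gs nd
  weaken₁-sem gs g         (var v)   = ≡.refl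
  weaken₁-sem gs g         (const a) = ≡.refl
  weaken₁-sem gs (add _ _) (gate i)  = ≡.refl
  weaken₁-sem gs (mul _ _) (gate i)  = ≡.refl

  weaken : ∀ {s t} {gs : G s} {hs : G t} → gs ≼ hs → N s → N t
  weaken ≼-refl     nd = nd
  weaken (≼-step x) nd = weaken₁ (weaken x nd)

  weaken-sem : ∀ {s t} {gs : G s} {hs : G t} (x : gs ≼ hs) nd →
               nodePoly hs (weaken x nd) ≋ nodePoly gs nd
  weaken-sem ≼-refl nd = ≋-reflexive ≡.refl
  weaken-sem (≼-step {hs = hs} {g = g} x) nd =
    ≋-trans (≋-reflexive (weaken₁-sem hs g (weaken x nd))) (weaken-sem x nd)

  data Op : Set where
    plus times : Op

  opGate : ∀ {s} → Op → N s → N s → Gate Y Carrier s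
  opGate plus  = add
  opGate times = mul

  opP : Op → NCPoly R Y → NCPoly R Y → NCPoly R Y
  opP plus  = _+P_
  opP times = _*P_

  opP-cong : ∀ o {p p′ q q′} → p ≋ p′ → q ≋ q′ → opP o p q ≋ opP o p′ q′
  opP-cong plus  p≋p′ q≋q′ w = +-cong (p≋p′ w) (q≋q′ w)
  opP-cong times p≋p′ q≋q′   = *P-cong p≋p′ q≋q′

  opGate-sem : ∀ {s} (gs : G s) o a b →
               gatePolys (gs ▷ opGate o a b) fzero ≡ opP o (nodePoly gs a) (nodePoly gs b)
  opGate-sem gs plus  a b = ≡.refl
  opGate-sem gs times a b = ≡.refl

  data Expr (s : ℕ) : Set (y ⊔ c) where
    leaf  : N s → Expr s
    apply : Op → Expr s → Expr s → Expr s

  infixl 6 _⊕_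
  infixl 7 _⊗_
  _⊕_ _⊗_ : ∀ {s} → Expr s → Expr s → Expr s
  _⊕_ = apply plus
  _⊗_ = apply times

  ⟦_⟧E : ∀ {s} → Expr s → G s → NCPoly R Y
  ⟦ leaf nd ⟧E        gs = nodePoly gs nd
  ⟦ apply o e₁ e₂ ⟧E gs = opP o (⟦ e₁ ⟧E gs) (⟦ e₂ ⟧E gs)

  cost : ∀ {s} → Expr s → ℕ
  cost (leaf _)        = 0
  cost (apply _ e₁ e₂) = suc (cost e₁ +ℕ cost e₂)

  record Compiled {s₀ s} (gs₀ : G s₀) (e : Expr s₀) (gs : G s) : Set (y ⊔ c ⊔ ℓ) where
    field
      t      : ℕ
      hs     : G t
      ext    : gs ≼ hs
      node   : N t
      sem    : nodePoly hs node ≋ ⟦ e ⟧E gs₀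
      size≡  : t ≡ s +ℕ cost e

  compile : ∀ {s₀ s} (gs₀ : G s₀) (e : Expr s₀) (gs : G s) → gs₀ ≼ gs → Compiled gs₀ e gs
  compile {s = s} gs₀ (leaf nd) gs x = record
    { t = s ; hs = gs ; ext = ≼-refl ; node = weaken x nd
    ; sem = weaken-sem x nd ; size≡ = ≡.sym (ℕP.+-identityʳ s) }
  compile {s = s} gs₀ (apply o e₁ e₂) gs x = record
    { t     = suc C₂.t
    ; hs    = C₂.hs ▷ opGate o a b
    ; ext   = ≼-step (≼-trans C₁.ext C₂.ext)
    ; node  = gate fzero
    ; sem   = ≋-trans (≋-reflexive (opGate-sem C₂.hs o a b))
                (opP-cong o (≋-trans (weaken-sem C₂.ext C₁.node) C₁.sem) C₂.sem)
    ; size≡ = ≡.trans (≡.cong suc (≡.trans C₂.size≡ (≡.trans (≡.cong (_+ℕ cost e₂) C₁.size≡)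
                                                      (ℕP.+-assoc s _ _))))
                      (≡.sym (ℕP.+-suc s _))
    }
    where
    module C₁ = Compiled (compile gs₀ e₁ gs x)
    module C₂ = Compiled (compile gs₀ e₂ C₁.hs (≼-trans x C₁.ext))
    a = weaken C₂.ext C₁.node
    b = C₂.node

  record CompiledAll {s₀ s} (gs₀ : G s₀) m (es : Fin m → Expr s₀) (gs : G s) (b : ℕ)
                     : Set (y ⊔ c ⊔ ℓ) where
    field
      t     : ℕ
      hs    : G t
      ext   : gs ≼ hs
      nodes : Fin m → N t
      sem   : ∀ i → nodePoly hs (nodes i) ≋ ⟦ es i ⟧E gs₀
      size≤ : t ≤ℕ s +ℕ m *ℕ b

  compileAll : ∀ {s₀ s} (gs₀ : G s₀) m (es : Fin m → Expr s₀) (gs : G s) → gs₀ ≼ gs →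
               (b : ℕ) → (∀ i → cost (es i) ≤ℕ b) → CompiledAll gs₀ m es gs b
  compileAll {s = s} gs₀ zero es gs x b cost≤ = record
    { t = s ; hs = gs ; ext = ≼-refl ; nodes = λ () ; sem = λ () ; size≤ = ℕP.m≤m+n s 0 }
  compileAll {s = s} gs₀ (suc m) es gs x b cost≤ = record
    { t     = Rest.t
    ; hs    = Rest.hs
    ; ext   = ≼-trans First.ext Rest.ext
    ; nodes = λ { fzero → weaken Rest.ext First.node ; (fsuc i) → Rest.nodes i }
    ; sem   = λ { fzero → ≋-trans (weaken-sem Rest.ext First.node) First.sem
                ; (fsuc i) → Rest.sem i }
    ; size≤ = begin
        Rest.t                       ≤⟨ Rest.size≤ ⟩
        First.t +ℕ m *ℕ b            ≡⟨ ≡.cong (_+ℕ m *ℕ b) First.size≡ ⟩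
        s +ℕ cost (es fzero) +ℕ m *ℕ b ≤⟨ ℕP.+-monoˡ-≤ (m *ℕ b) (ℕP.+-monoʳ-≤ s (cost≤ fzero)) ⟩
        s +ℕ b +ℕ m *ℕ b             ≡⟨ ℕP.+-assoc s b (m *ℕ b) ⟩
        s +ℕ suc m *ℕ b              ∎
    }
    where
    open ℕP.≤-Reasoning
    module First = Compiled (compile gs₀ (es fzero) gs x)
    module Rest = CompiledAll (compileAll gs₀ m (λ i → es (fsuc i)) First.hs
                                 (≼-trans x First.ext) b (λ i → cost≤ (fsuc i)))

  sumE : ∀ {s} m → (Fin m → Expr s) → Expr s
  sumE zero    es = leaf (const 0#)
  sumE (suc m) es = es fzero ⊕ sumE m (λ i → es (fsuc i))

  sumE-sem : ∀ {s} (gs : G s) m es w → ⟦ sumE m es ⟧E gs w ≈ ∑[ i < m ] (⟦ es i ⟧E gs w)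
  sumE-sem gs zero    es w = constP-0 w
  sumE-sem gs (suc m) es w = +-congˡ (sumE-sem gs m _ w)

  sumE-cost : ∀ {s} m (es : Fin m → Expr s) b → (∀ i → cost (es i) ≤ℕ b) →
              cost (sumE m es) ≤ℕ m *ℕ suc b
  sumE-cost zero    es b cost≤ = z≤n
  sumE-cost (suc m) es b cost≤ = s≤s (ℕP.+-mono-≤ (cost≤ fzero) (sumE-cost m _ b (λ i → cost≤ (fsuc i))))

module Size where
  open ℕP.≤-Reasoning

  add-group : ∀ a b {s t t′} → t ≤ℕ a +ℕ s *ℕ b → t′ ≤ℕ t +ℕ b → t′ ≤ℕ a +ℕ suc s *ℕ b
  add-group a b {s} {t} {t′} t≤ t′≤ = begin
    t′                      ≤⟨ t′≤ ⟩
    t +ℕ b                  ≤⟨ ℕP.+-monoˡ-≤ b t≤ ⟩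
    a +ℕ s *ℕ b +ℕ b        ≡⟨ ℕP.+-assoc a (s *ℕ b) b ⟩
    a +ℕ (s *ℕ b +ℕ b)      ≡⟨ ≡.cong (a +ℕ_) (ℕP.+-comm (s *ℕ b) b) ⟩
    a +ℕ suc s *ℕ b         ∎

  polynomial : ∀ a e m s → let n = suc m ; b = n *ℕ 3 +ℕ 1 in
               s ≤ℕ a *ℕ n ^ e +ℕ a →
               n *ℕ b +ℕ s *ℕ (n *ℕ n *ℕ b) +ℕ b ≤ℕ 8 *ℕ (a +ℕ 2) *ℕ n ^ (3 +ℕ e) +ℕ 8 *ℕ (a +ℕ 2)
  polynomial a e m s s≤ = begin
    n *ℕ b +ℕ s *ℕ Q +ℕ b            ≤⟨ ℕP.+-mono-≤ (ℕP.+-monoˡ-≤ (s *ℕ Q) n*b≤Q) b≤Q ⟩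
    Q +ℕ s *ℕ Q +ℕ Q                 ≡⟨ solve 2 (λ s Q → Q :+ s :* Q :+ Q := (s :+ con 2) :* Q) ≡.refl s Q ⟩
    (s +ℕ 2) *ℕ Q                    ≤⟨ ℕP.*-mono-≤ (ℕP.+-monoˡ-≤ 2 s≤) Q≤ ⟩
    (a *ℕ x +ℕ a +ℕ 2) *ℕ (n *ℕ n *ℕ (n *ℕ 4))
                                     ≤⟨ ℕP.*-monoˡ-≤ (n *ℕ n *ℕ (n *ℕ 4)) ax+a+2≤ ⟩
    (a +ℕ 2) *ℕ (x +ℕ x) *ℕ (n *ℕ n *ℕ (n *ℕ 4))
                                     ≡⟨ solve 3 (λ a x n → (a :+ con 2) :* (x :+ x) :* (n :* n :* (n :* con 4))
                                                         := con 8 :* (a :+ con 2) :* (n :* (n :* (n :* x)))) ≡.refl a x n ⟩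
    8 *ℕ (a +ℕ 2) *ℕ n ^ (3 +ℕ e)    ≤⟨ ℕP.m≤m+n _ _ ⟩
    8 *ℕ (a +ℕ 2) *ℕ n ^ (3 +ℕ e) +ℕ 8 *ℕ (a +ℕ 2) ∎
    where
    open +-*-Solver
    n = suc m
    b = n *ℕ 3 +ℕ 1
    Q = n *ℕ n *ℕ b
    x = n ^ e

    1≤n : 1 ≤ℕ n
    1≤n = s≤s z≤n

    b≤Q : b ≤ℕ Q
    b≤Q = ℕP.m≤n*m b (n *ℕ n)

    n*b≤Q : n *ℕ b ≤ℕ Q
    n*b≤Q = ℕP.*-monoˡ-≤ b (ℕP.m≤m*n n n)

    Q≤ : Q ≤ℕ n *ℕ n *ℕ (n *ℕ 4)
    Q≤ = ℕP.*-monoʳ-≤ (n *ℕ n) (ℕP.≤-trans (ℕP.+-monoʳ-≤ (n *ℕ 3) 1≤n)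
                                  (ℕP.≤-reflexive (solve 1 (λ n → n :* con 3 :+ n := n :* con 4) ≡.refl n)))

    ax+a+2≤ : a *ℕ x +ℕ a +ℕ 2 ≤ℕ (a +ℕ 2) *ℕ (x +ℕ x)
    ax+a+2≤ = begin
      a *ℕ x +ℕ a +ℕ 2           ≡⟨ ℕP.+-assoc (a *ℕ x) a 2 ⟩
      a *ℕ x +ℕ (a +ℕ 2)         ≤⟨ ℕP.+-mono-≤ (ℕP.*-monoˡ-≤ x (ℕP.m≤m+n a 2)) (ℕP.m≤m*n (a +ℕ 2) x {{ℕP.m^n≢0 n e}}) ⟩
      (a +ℕ 2) *ℕ x +ℕ (a +ℕ 2) *ℕ x ≡⟨ ≡.sym (ℕP.*-distribˡ-+ (a +ℕ 2) x x) ⟩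
      (a +ℕ 2) *ℕ (x +ℕ x)       ∎

-- Blocks of sums and products are sums and matrix products of blocks, and
-- the blocks of x_j are Σ_i d i y_ij on the diagonal and 0 off it.
module Blocks {c₁ ℓ₁ c₂ ℓ₂} (K : Field c₁ ℓ₁) (A : Algebra K c₂ ℓ₂) (m : ℕ)
              (M : ContainsMat K A (suc m)) where
  n : ℕ
  n = suc m

  open Algebra A
  open Sums ring
  open MatrixUnits K A n M
  open SetoidReasoning setoid

  X : Set
  X = Fin n

  Y : Set
  Y = Fin n × Fin n

  _≟Y_ : DecidableEquality Y
  _≟Y_ = ≡-dec _≟_ _≟_

  module SX = Semantics ring (_≟_ {n})
  module SY = Semantics ring _≟Y_
  module PX = Poly ring (_≟_ {n})
  module PY = Poly ring _≟Y_

  next : Fin n → Fin n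
  next i = fromℕ< (m%n<n (suc (toℕ i)) n)

  d : Fin n → Carrier
  d i = e i (next i)

  columns : List Y → List X
  columns = map proj₂

  weight : List Y → Carrier
  weight []      = 1#
  weight (y ∷ w) = d (proj₁ y) * weight w

  sumL-XY : ∀ (l : List Carrier) → SX.sumL l ≈ SY.sumL l
  sumL-XY []      = refl
  sumL-XY (a ∷ l) = +-congˡ (sumL-XY l)

  splits-columns : ∀ w → splits (columns w) ≡ map (λ (u , v) → columns u , columns v) (splits w)
  splits-columns []      = ≡.refl
  splits-columns (y ∷ w) = ≡.cong (([] , columns (y ∷ w)) ∷_)
    (≡.trans (≡.cong (map _) (splits-columns w)) (≡.trans (≡.sym (map-∘ (splits w))) (map-∘ (splits w))))

  weight-splits : ∀ w → All (λ (u , v) → weight w ≈ weight u * weight v) (splits w)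
  weight-splits []      = sym (*-identityˡ 1#) ∷ []
  weight-splits (y ∷ w) = sym (*-identityˡ _) ∷
    AllP.map⁺ (All.map (λ w≈uv → trans (*-congˡ w≈uv) (sym (*-assoc _ _ _))) (weight-splits w))

  commute-weight : ∀ a → (∀ i → a * d i ≈ d i * a) → ∀ u → a * weight u ≈ weight u * a
  commute-weight a a-d []      = trans (*-identityʳ a) (sym (*-identityˡ a))
  commute-weight a a-d (y ∷ u) = begin
    a * (d (proj₁ y) * weight u)  ≈⟨ sym (*-assoc _ _ _) ⟩
    (a * d (proj₁ y)) * weight u  ≈⟨ *-congʳ (a-d (proj₁ y)) ⟩
    (d (proj₁ y) * a) * weight u  ≈⟨ *-assoc _ _ _ ⟩
    d (proj₁ y) * (a * weight u)  ≈⟨ *-congˡ (commute-weight a a-d u) ⟩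
    d (proj₁ y) * (weight u * a)  ≈⟨ sym (*-assoc _ _ _) ⟩
    (d (proj₁ y) * weight u) * a  ∎

  twist : NCPoly ring X → NCPoly ring Y
  twist P w = P (columns w) * weight w

  twist-*P : ∀ P Q → (∀ v i → Q v * d i ≈ d i * Q v) →
             ∀ w → SY._*P_ (twist P) (twist Q) w ≈ twist (SX._*P_ P Q) w
  twist-*P P Q Q-d w = begin
    SY.sumL (map (λ (u , v) → twist P u * twist Q v) (splits w))
      ≈⟨ PY.sumL-cong-All (All.map regroup (weight-splits w)) ⟩
    SY.sumL (map (λ (u , v) → coefficient (u , v) * weight w) (splits w))
      ≈⟨ sym (PY.sumL-*ʳ (splits w) coefficient (weight w)) ⟩
    SY.sumL (map coefficient (splits w)) * weight w
      ≈⟨ *-congʳ (sym (sumL-XY (map coefficient (splits w)))) ⟩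
    SX.sumL (map coefficient (splits w)) * weight w
      ≡⟨ ≡.cong (λ l → SX.sumL l * weight w)
                (≡.trans (map-∘ (splits w)) (≡.cong (map _) (≡.sym (splits-columns w)))) ⟩
    twist (SX._*P_ P Q) w ∎
    where
    coefficient : List Y × List Y → Carrier
    coefficient (u , v) = P (columns u) * Q (columns v)

    regroup : ∀ {u v} → weight w ≈ weight u * weight v →
              twist P u * twist Q v ≈ coefficient (u , v) * weight w
    regroup {u} {v} w≈uv = begin
      (P (columns u) * weight u) * (Q (columns v) * weight v)
        ≈⟨ *-assoc _ _ _ ⟩
      P (columns u) * (weight u * (Q (columns v) * weight v))
        ≈⟨ *-congˡ (sym (*-assoc _ _ _)) ⟩
      P (columns u) * ((weight u * Q (columns v)) * weight v)
        ≈⟨ *-congˡ (*-congʳ (sym (commute-weight _ (Q-d (columns v)) u))) ⟩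
      P (columns u) * ((Q (columns v) * weight u) * weight v)
        ≈⟨ *-congˡ (*-assoc _ _ _) ⟩
      P (columns u) * (Q (columns v) * (weight u * weight v))
        ≈⟨ sym (*-assoc _ _ _) ⟩
      coefficient (u , v) * (weight u * weight v)
        ≈⟨ *-congˡ (sym w≈uv) ⟩
      coefficient (u , v) * weight w ∎

  block : NCPoly ring X → Fin n → Fin n → NCPoly ring Y
  block P p q = twist (λ v → coord p q (P v))

  block-cong : ∀ {P Q} → _≈P_ ring P Q → ∀ p q → PY._≋_ (block P p q) (block Q p q)
  block-cong P≋Q p q w = *-congʳ (coord-cong p q (P≋Q (columns w)))

  block-+ : ∀ P Q p q w → SY._+P_ (block P p q) (block Q p q) w ≈ block (SX._+P_ P Q) p q w
  block-+ P Q p q w = trans (sym (distribʳ _ _ _)) (*-congʳ (sym (coord-+ p q _ _)))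

  block-* : ∀ P Q p q w →
            ∑[ r < n ] (SY._*P_ (block P p r) (block Q r q) w) ≈ block (SX._*P_ P Q) p q w
  block-* P Q p q w = begin
    ∑[ r < n ] (SY._*P_ (block P p r) (block Q r q) w)
      ≈⟨ sum-cong-≋ {n} (λ r → twist-*P (λ v → coord p r (P v)) (λ v → coord r q (Q v)) (λ v i → coord-central r q (Q v) i (next i)) w) ⟩
    ∑[ r < n ] (SX.sumL (map (products r) (splits (columns w))) * weight w)
      ≈⟨ sym (*-distribʳ-sum {n} (weight w) (λ r → SX.sumL (map (products r) (splits (columns w))))) ⟩
    ∑[ r < n ] (SX.sumL (map (products r) (splits (columns w)))) * weight w
      ≈⟨ *-congʳ (PX.sum-sumL n (splits (columns w)) products) ⟩
    SX.sumL (map (λ uv → ∑[ r < n ] (products r uv)) (splits (columns w))) * weight w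
      ≈⟨ *-congʳ (PX.sumL-cong (splits (columns w)) (λ (u , v) → coord-* p q (P u) (Q v))) ⟩
    SX.sumL (map (λ (u , v) → coord p q (P u * Q v)) (splits (columns w))) * weight w
      ≈⟨ *-congʳ (sym (PX.additive-sumL (coord p q) (coord-cong p q) (coord-+ p q) (splits (columns w)) _)) ⟩
    block (SX._*P_ P Q) p q w ∎
    where
    products : Fin n → List X × List X → Carrier
    products r (u , v) = coord p r (P u) * coord r q (Q v)

  block-const : ∀ a p q w → SY.constP (coord p q a) w ≈ block (SX.constP a) p q w
  block-const a p q []      = sym (*-identityʳ _)
  block-const a p q (y ∷ w) = sym (trans (*-congʳ (Coord.h-0 p q)) (zeroˡ _))

  block-var-offdiagonal : ∀ j p q → ¬ p ≡ q → ∀ w → SY.constP 0# w ≈ block (SX.varP j) p q w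
  block-var-offdiagonal j p q p≢q w =
    trans (PY.constP-0 w) (sym (trans (*-congʳ (coord-varP (columns w))) (zeroˡ _)))
    where
    coord-varP : ∀ u → coord p q (SX.varP j u) ≈ 0#
    coord-varP []          = Coord.h-0 p q
    coord-varP (x ∷ [])    with j ≟ x
    ... | yes _ = coord-1-offdiagonal p q p≢q
    ... | no _  = Coord.h-0 p q
    coord-varP (_ ∷ _ ∷ _) = Coord.h-0 p q

  substituted : Fin n → NCPoly ring Y
  substituted j w = ∑[ i < n ] (SY._*P_ (SY.constP (d i)) (SY.varP (i , j)) w)

  block-var-diagonal : ∀ j p w → substituted j w ≈ block (SX.varP j) p p w
  block-var-diagonal j p w =
    trans (sum-cong-≋ {n} (λ i → PY.constP-*P (d i) (SY.varP (i , j)) w)) (coefficients w)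
    where
    vanishing : ∀ w → (∀ i → SY.varP (i , j) w ≈ 0#) → ∀ {x} → x ≈ 0# →
                ∑[ i < n ] (d i * SY.varP (i , j) w) ≈ x * weight w
    vanishing w varP≈0 x≈0 =
      trans (sum-zero n {λ i → d i * SY.varP (i , j) w} (λ i → trans (*-congˡ (varP≈0 i)) (zeroʳ _))) (sym (trans (*-congʳ x≈0) (zeroˡ _)))

    coefficients : ∀ w → ∑[ i < n ] (d i * SY.varP (i , j) w) ≈ block (SX.varP j) p p w
    coefficients []                  = vanishing [] (λ i → refl) (Coord.h-0 p p)
    coefficients ((i′ , j′) ∷ [])    with j ≟ j′
    ... | yes ≡.refl = begin
      ∑[ i < n ] (d i * SY.varP (i , j) ((i′ , j) ∷ []))
        ≈⟨ sum-δ n (λ i → d i * SY.varP (i , j) ((i′ , j) ∷ [])) i′ (λ i i≢i′ → trans (*-congˡ (PY.varP-other _ _ (λ eq → i≢i′ (≡.cong proj₁ eq))))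
                                          (zeroʳ _)) ⟩
      d i′ * SY.varP (i′ , j) ((i′ , j) ∷ [])
        ≈⟨ trans (*-congˡ (PY.varP-self (i′ , j))) (*-identityʳ _) ⟩
      d i′
        ≈⟨ sym (trans (*-congʳ (coord-1-diagonal p)) (trans (*-identityˡ _) (*-identityʳ _))) ⟩
      coord p p 1# * (d i′ * 1#) ∎
    ... | no j≢j′ = vanishing ((i′ , j′) ∷ []) (λ i → PY.varP-other (i , j) (i′ , j′) (λ eq → j≢j′ (≡.cong proj₂ eq))) (Coord.h-0 p p)
    coefficients (a ∷ b ∷ w)         = vanishing (a ∷ b ∷ w) (λ i → refl) (Coord.h-0 p p)

-- Conjugating by the units e k 0, e 0 k and summing
-- over k turns the weight of a word of length n into 1 when its rows are
-- 0, 1, …, n-1 in order and into 0 otherwise, which keeps precisely the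
-- words of the Cayley determinant.
module Readout {c₁ ℓ₁ c₂ ℓ₂} (K : Field c₁ ℓ₁) (A : Algebra K c₂ ℓ₂) (m : ℕ)
               (M : ContainsMat K A (suc m)) where
  open Algebra A
  open Sums ring
  open MatrixUnits K A (suc m) M
  open Blocks K A m M
  open SetoidReasoning setoid

  module PolR = Polys ring

  index<n : ∀ {y : Y} {w i} → length (y ∷ w) +ℕ i ≡ n → i ℕ.< n
  index<n {i = i} len = ≡.subst (i ℕ.<_) len (ℕP.m<n+m i (s≤s z≤n))

  -- rows in order i, i+1, … (mod n) make the weight a path of matrix units
  weight-path : ∀ w i (r : Fin n) x → length w +ℕ i ≡ n → toℕ r ≡ i % n →
                e x r * weight w ≈ (if PolR.rowsInOrder i w then e x fzero else 0#)
  weight-path [] i r x len r≡i = trans (*-identityʳ _) (reflexive (≡.cong (e x) r≡0))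
    where
    r≡0 : r ≡ fzero
    r≡0 = toℕ-injective (≡.trans r≡i (≡.trans (≡.cong (_% n) len) (n%n≡0 n)))
  weight-path ((a , b) ∷ w) i r x len r≡i with toℕ a ℕ.≟ i
  ... | yes a≡i = begin
    e x r * (d a * weight w)  ≈⟨ sym (*-assoc _ _ _) ⟩
    (e x r * d a) * weight w  ≈⟨ *-congʳ (reflexive (≡.cong (λ z → e x z * d a) r≡a)) ⟩
    (e x a * d a) * weight w  ≈⟨ *-congʳ (e-mul-match x a (next a)) ⟩
    e x (next a) * weight w   ≈⟨ weight-path w (suc i) (next a) x (≡.trans (ℕP.+-suc (length w) i) len)
                                   (≡.trans (toℕ-fromℕ< _) (≡.cong (λ z → suc z % n) a≡i)) ⟩
    _ ∎
    where
    r≡a : r ≡ a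
    r≡a = toℕ-injective (≡.trans r≡i (≡.trans (m<n⇒m%n≡m (index<n {y = (a , b)} {w = w} len)) (≡.sym a≡i)))
  ... | no a≢i = trans (sym (*-assoc _ _ _)) (trans (*-congʳ (e-mul-mismatch x r a (next a) r≢a)) (zeroˡ _))
    where
    r≢a : ¬ r ≡ a
    r≢a r≡a = a≢i (≡.trans (≡.cong toℕ (≡.sym r≡a)) (≡.trans r≡i (m<n⇒m%n≡m (index<n {y = (a , b)} {w = w} len))))

  rowCheck : List Y → Carrier
  rowCheck w = ∑[ k < n ] ((e k fzero * weight w) * e fzero k)

  rowCheck-value : ∀ w → length w ≡ n →
                   rowCheck w ≈ ∑[ k < n ] ((if PolR.rowsInOrder 0 w then e k fzero else 0#) * e fzero k)
  rowCheck-value w len = sum-cong-≋ {n} {λ k → (e k fzero * weight w) * e fzero k} (λ k →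
    *-congʳ (weight-path w 0 fzero k (≡.trans (ℕP.+-identityʳ _) len) ≡.refl))

  rowCheck-ordered : ∀ w → length w ≡ n → PolR.rowsInOrder 0 w ≡ true → rowCheck w ≈ 1#
  rowCheck-ordered w len ordered = begin
    rowCheck w                                     ≈⟨ rowCheck-value w len ⟩
    ∑[ k < n ] ((if PolR.rowsInOrder 0 w then e k fzero else 0#) * e fzero k)
                                                   ≡⟨ ≡.cong (λ b → ∑[ k < n ] ((if b then e k fzero else 0#) * e fzero k)) ordered ⟩
    ∑[ k < n ] (e k fzero * e fzero k)            ≈⟨ sum-cong-≋ {n} (λ k → e-mul-match k fzero k) ⟩
    ∑[ k < n ] e k k                               ≈⟨ e-complete ⟩
    1# ∎

  rowCheck-unordered : ∀ w → length w ≡ n → PolR.rowsInOrder 0 w ≡ false → rowCheck w ≈ 0#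
  rowCheck-unordered w len unordered = begin
    rowCheck w                                     ≈⟨ rowCheck-value w len ⟩
    ∑[ k < n ] ((if PolR.rowsInOrder 0 w then e k fzero else 0#) * e fzero k)
                                                   ≡⟨ ≡.cong (λ b → ∑[ k < n ] ((if b then e k fzero else 0#) * e fzero k)) unordered ⟩
    ∑[ k < n ] (0# * e fzero k)                    ≈⟨ sum-zero n {λ k → 0# * e fzero k} (λ k → zeroˡ _) ⟩
    0# ∎

  -- signs lie in the centraliser, so they are their own (0, 0) coordinate
  coord-sign : ∀ t → coord fzero fzero (PolR.signR t) ≈ PolR.signR t
  coord-sign zero                = coord-1-diagonal fzero
  coord-sign (suc zero)          = trans (Coord.h-neg fzero fzero 1#) (-‿cong (coord-1-diagonal fzero))
  coord-sign (suc (suc t))       = coord-sign t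

  length-columns : ∀ {w} → length (columns w) ≡ n → length w ≡ n
  length-columns {w} len = ≡.trans (≡.sym (length-map proj₂ w)) len

  cdet-from-sncSym : ∀ w → coord fzero fzero (PolR.sncSym n (columns w)) * rowCheck w ≈ PolR.cdet n w
  cdet-from-sncSym w with PolR.rowsInOrder 0 w in rows | isPerm? n (columns w)
  ... | true  | yes (len , _) =
    trans (*-cong (coord-sign (inversions (columns w))) (rowCheck-ordered w (length-columns {w} len) rows))
          (*-identityʳ _)
  ... | false | yes (len , _) = trans (*-congˡ (rowCheck-unordered w (length-columns {w} len) rows)) (zeroʳ _)
  ... | true  | no _          = trans (*-congʳ (Coord.h-0 fzero fzero)) (zeroˡ _)
  ... | false | no _          = trans (*-congʳ (Coord.h-0 fzero fzero)) (zeroˡ _)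

  readout : ∀ P w → ∑[ k < n ] ((e k fzero * block P fzero fzero w) * e fzero k) ≈
                    coord fzero fzero (P (columns w)) * rowCheck w
  readout P w = begin
    ∑[ k < n ] ((e k fzero * (c * weight w)) * e fzero k)
      ≈⟨ sum-cong-≋ {n} {λ k → (e k fzero * (c * weight w)) * e fzero k} (λ k → begin
           (e k fzero * (c * weight w)) * e fzero k ≈⟨ *-congʳ (sym (*-assoc _ _ _)) ⟩
           ((e k fzero * c) * weight w) * e fzero k ≈⟨ *-congʳ (*-congʳ (sym (coord-central _ _ _ k fzero))) ⟩
           ((c * e k fzero) * weight w) * e fzero k ≈⟨ *-congʳ (*-assoc _ _ _) ⟩
           (c * (e k fzero * weight w)) * e fzero k ≈⟨ *-assoc _ _ _ ⟩
           c * ((e k fzero * weight w) * e fzero k) ∎) ⟩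
    ∑[ k < n ] (c * ((e k fzero * weight w) * e fzero k))
      ≈⟨ sym (*-distribˡ-sum {n} c (λ k → (e k fzero * weight w) * e fzero k)) ⟩
    c * rowCheck w ∎
    where
    c = coord fzero fzero (P (columns w))

-- Every gate of a circuit over X is replaced by
-- the n² groups of gates computing its blocks; each group costs at most
-- `budget` gates.
module Simulation {c₁ ℓ₁ c₂ ℓ₂} (K : Field c₁ ℓ₁) (A : Algebra K c₂ ℓ₂) (m : ℕ)
                  (M : ContainsMat K A (suc m)) where
  open Algebra A
  open Sums ring
  open MatrixUnits K A (suc m) M
  open Blocks K A m M
  open Readout K A m M
  open SetoidReasoning setoid

  module B = Builder ring _≟Y_
  open B using (_⊕_; _⊗_; leaf; ⟦_⟧E; cost; sumE; weaken; weaken-sem)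
  open PY using (_≋_; ≋-trans; ≋-reflexive)

  budget : ℕ
  budget = n *ℕ 3 +ℕ 1

  n*2≤budget : n *ℕ 2 ≤ℕ budget
  n*2≤budget = ℕP.≤-trans (ℕP.*-monoʳ-≤ n (s≤s (s≤s z≤n))) (ℕP.m≤m+n (n *ℕ 3) 1)

  record Translation {s} (gs : Gates X Carrier s) : Set (c₂ ⊔ ℓ₂) where
    field
      t             : ℕ
      hs            : B.G t
      blockNode     : Fin s → Fin n → Fin n → B.N t
      varNode       : Fin n → B.N t
      blockNode-sem : ∀ i p q → SY.nodePoly hs (blockNode i p q) ≋ block (SX.gatePolys gs i) p q
      varNode-sem   : ∀ j → SY.nodePoly hs (varNode j) ≋ substituted j
      size≤         : t ≤ℕ n *ℕ budget +ℕ s *ℕ (n *ℕ n *ℕ budget)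

  module _ {s} {gs : Gates X Carrier s} (T : Translation gs) where
    open Translation T

    nodeBlock : Node X Carrier s → Fin n → Fin n → B.N t
    nodeBlock (var j)   p q with p ≟ q
    ... | yes _ = varNode j
    ... | no _  = const 0#
    nodeBlock (const a) p q = const (coord p q a)
    nodeBlock (gate i)  p q = blockNode i p q

    nodeBlock-sem : ∀ nd p q → SY.nodePoly hs (nodeBlock nd p q) ≋ block (SX.nodePoly gs nd) p q
    nodeBlock-sem (var j)   p q with p ≟ q
    ... | yes ≡.refl = λ w → trans (varNode-sem j w) (block-var-diagonal j p w)
    ... | no p≢q     = block-var-offdiagonal j p q p≢q
    nodeBlock-sem (const a) p q = block-const a p q
    nodeBlock-sem (gate i)  p q = blockNode-sem i p q

    gateBlock : Gate X Carrier s → Fin n → Fin n → B.Expr t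
    gateBlock (add a b) p q = leaf (nodeBlock a p q) ⊕ leaf (nodeBlock b p q)
    gateBlock (mul a b) p q = sumE n (λ r → leaf (nodeBlock a p r) ⊗ leaf (nodeBlock b r q))

    gateBlock-sem : ∀ g p q → ⟦ gateBlock g p q ⟧E hs ≋ block (SX.gatePolys (gs ▷ g) fzero) p q
    gateBlock-sem (add a b) p q w =
      trans (+-cong (nodeBlock-sem a p q w) (nodeBlock-sem b p q w)) (block-+ (SX.nodePoly gs a) (SX.nodePoly gs b) p q w)
    gateBlock-sem (mul a b) p q w = begin
      ⟦ gateBlock (mul a b) p q ⟧E hs w
        ≈⟨ B.sumE-sem hs n (λ r → leaf (nodeBlock a p r) ⊗ leaf (nodeBlock b r q)) w ⟩
      ∑[ r < n ] (⟦ leaf (nodeBlock a p r) ⊗ leaf (nodeBlock b r q) ⟧E hs w)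
        ≈⟨ sum-cong-≋ {n} {λ r → ⟦ leaf (nodeBlock a p r) ⊗ leaf (nodeBlock b r q) ⟧E hs w}
             (λ r → PY.*P-cong (nodeBlock-sem a p r) (nodeBlock-sem b r q) w) ⟩
      ∑[ r < n ] (SY._*P_ (block (SX.nodePoly gs a) p r) (block (SX.nodePoly gs b) r q) w)
        ≈⟨ block-* (SX.nodePoly gs a) (SX.nodePoly gs b) p q w ⟩
      block (SX.gatePolys (gs ▷ mul a b) fzero) p q w ∎

    gateBlock-cost : ∀ g p q → cost (gateBlock g p q) ≤ℕ budget
    gateBlock-cost (add a b) p q = ℕP.m≤n+m 1 (n *ℕ 3)
    gateBlock-cost (mul a b) p q =
      ℕP.≤-trans (B.sumE-cost n (λ r → leaf (nodeBlock a p r) ⊗ leaf (nodeBlock b r q)) 1 (λ r → ℕP.≤-refl))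
                 n*2≤budget

    extend : (g : Gate X Carrier s) → Translation (gs ▷ g)
    extend g = record
      { t             = New.t
      ; hs            = New.hs
      ; blockNode     = blockNode′
      ; varNode       = λ j → weaken New.ext (varNode j)
      ; blockNode-sem = blockNode′-sem
      ; varNode-sem   = λ j → ≋-trans (weaken-sem New.ext (varNode j)) (varNode-sem j)
      ; size≤         = Size.add-group (n *ℕ budget) (n *ℕ n *ℕ budget) {s} size≤ New.size≤
      }
      where
      entry : Fin (n *ℕ n) → Fin n × Fin n
      entry = remQuot {n} n

      blocks : Fin (n *ℕ n) → B.Expr t
      blocks k = gateBlock g (proj₁ (entry k)) (proj₂ (entry k))

      module New = B.CompiledAll (B.compileAll hs (n *ℕ n) blocks hs B.≼-refl budget
                                   (λ k → gateBlock-cost g (proj₁ (entry k)) (proj₂ (entry k))))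

      blockNode′ : Fin (suc s) → Fin n → Fin n → B.N New.t
      blockNode′ fzero    p q = New.nodes (combine p q)
      blockNode′ (fsuc i) p q = weaken New.ext (blockNode i p q)

      blockNode′-sem : ∀ i p q → SY.nodePoly New.hs (blockNode′ i p q) ≋ block (SX.gatePolys (gs ▷ g) i) p q
      blockNode′-sem fzero p q = ≋-trans (New.sem (combine p q))
        (≋-trans (≋-reflexive (≡.cong (λ (p′ , q′) → ⟦ gateBlock g p′ q′ ⟧E hs) (remQuot-combine {n} {n} p q)))
                 (gateBlock-sem g p q))
      blockNode′-sem (fsuc i) p q = ≋-trans (weaken-sem New.ext (blockNode i p q))
        (≋-trans (blockNode-sem i p q) (≋-reflexive (≡.cong (λ P → block P p q) (earlier-gate g i))))
        where
        earlier-gate : ∀ g i → SX.gatePolys gs i ≡ SX.gatePolys (gs ▷ g) (fsuc i)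
        earlier-gate (add _ _) i = ≡.refl
        earlier-gate (mul _ _) i = ≡.refl

  initial : Translation []
  initial = record
    { t = Vars.t ; hs = Vars.hs ; blockNode = λ () ; varNode = Vars.nodes
    ; blockNode-sem = λ ()
    ; varNode-sem   = λ j w → trans (Vars.sem j w) (B.sumE-sem [] n (summands j) w)
    ; size≤         = ℕP.≤-trans Vars.size≤ (ℕP.≤-reflexive (≡.sym (ℕP.+-identityʳ (n *ℕ budget))))
    }
    where
    summands : Fin n → Fin n → B.Expr 0
    summands j i = leaf (const (d i)) ⊗ leaf (var (i , j))

    cost≤ : ∀ j → cost (sumE n (summands j)) ≤ℕ budget
    cost≤ j = ℕP.≤-trans (B.sumE-cost n (summands j) 1 (λ i → ℕP.≤-refl)) n*2≤budget

    module Vars = B.CompiledAll (B.compileAll [] n (λ j → sumE n (summands j)) [] B.≼-refl budget cost≤)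

  translate : ∀ {s} (gs : Gates X Carrier s) → Translation gs
  translate []       = initial
  translate (gs ▷ g) = extend (translate gs) g

  simulate : (C : Circuit X Carrier) → _≈P_ ring (SX.⟦_⟧ C) (PolR.sncSym n) →
             Σ (Circuit Y Carrier) λ C′ →
               (size C′ ≤ℕ n *ℕ budget +ℕ size C *ℕ (n *ℕ n *ℕ budget) +ℕ budget)
               × _≈P_ ring (SY.⟦_⟧ C′) (PolR.cdet n)
  simulate (circuit s gs out) C≋sncSym =
    circuit Out.t Out.hs Out.node , size-ok , λ w → trans (Out.sem w) (output-sem w)
    where
    module T = Translation (translate gs)

    conjugated : Fin n → B.Expr T.t
    conjugated k = (leaf (const (e k fzero)) ⊗ leaf (nodeBlock (translate gs) out fzero fzero))
                     ⊗ leaf (const (e fzero k))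

    module Out = B.Compiled (B.compile T.hs (sumE n conjugated) T.hs B.≼-refl)

    size-ok : Out.t ≤ℕ n *ℕ budget +ℕ s *ℕ (n *ℕ n *ℕ budget) +ℕ budget
    size-ok = ℕP.≤-trans (ℕP.≤-reflexive Out.size≡)
      (ℕP.+-mono-≤ T.size≤ (ℕP.≤-trans (B.sumE-cost n conjugated 2 (λ k → ℕP.≤-refl)) (ℕP.m≤m+n (n *ℕ 3) 1)))

    sncSym-block : PY._≋_ (⟦ leaf (nodeBlock (translate gs) out fzero fzero) ⟧E T.hs)
                          (block (PolR.sncSym n) fzero fzero)
    sncSym-block = ≋-trans (nodeBlock-sem (translate gs) out fzero fzero) (block-cong C≋sncSym fzero fzero)

    output-sem : ∀ w → ⟦ sumE n conjugated ⟧E T.hs w ≈ PolR.cdet n w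
    output-sem w = begin
      ⟦ sumE n conjugated ⟧E T.hs w
        ≈⟨ B.sumE-sem T.hs n conjugated w ⟩
      ∑[ k < n ] (⟦ conjugated k ⟧E T.hs w)
        ≈⟨ sum-cong-≋ {n} {λ k → ⟦ conjugated k ⟧E T.hs w} (λ k → begin
             ⟦ conjugated k ⟧E T.hs w
               ≈⟨ PY.*P-constP _ (e fzero k) w ⟩
             SY._*P_ (SY.constP (e k fzero)) (⟦ leaf (nodeBlock (translate gs) out fzero fzero) ⟧E T.hs) w * e fzero k
               ≈⟨ *-congʳ (PY.constP-*P (e k fzero) _ w) ⟩
             (e k fzero * ⟦ leaf (nodeBlock (translate gs) out fzero fzero) ⟧E T.hs w) * e fzero k
               ≈⟨ *-congʳ (*-congˡ (sncSym-block w)) ⟩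
             (e k fzero * block (PolR.sncSym n) fzero fzero w) * e fzero k ∎) ⟩
      ∑[ k < n ] ((e k fzero * block (PolR.sncSym n) fzero fzero w) * e fzero k)
        ≈⟨ readout (PolR.sncSym n) w ⟩
      coord fzero fzero (PolR.sncSym n (columns w)) * rowCheck w
        ≈⟨ cdet-from-sncSym w ⟩
      PolR.cdet n w ∎

-- For n = 0 the constant 1 computes
-- C-det_0; for n ≥ 1 the simulation turns a circuit of size s ≤ a·nᵉ + a
-- for snc-Sym_{n,n} into one for C-det_n of size at most 8(a+2)·n^(3+e) + 8(a+2).
corollary4 : ∀ {k ℓk r ℓr} (K : Field k ℓk) (R : ℕ → Algebra K r ℓr)
    → (∀ n → ContainsMat K (R n) n)
    → HasPolySizeCircuits (λ n → Algebra.ring (R n)) Fin (λ n → _≟_)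
        (λ n → Polys.sncSym (Algebra.ring (R n)) n)
    → HasPolySizeCircuits (λ n → Algebra.ring (R n)) (λ n → Fin n × Fin n)
        (λ n → ≡-dec _≟_ _≟_)
        (λ n → Polys.cdet (Algebra.ring (R n)) n)
corollary4 K R M (a , e , sncSym-circuit) = 8 *ℕ (a +ℕ 2) , 3 +ℕ e , cdet-circuit
  where
  cdet-circuit : ∀ n → Σ (Circuit (Fin n × Fin n) (Algebra.Carrier (R n))) λ C →
                   (size C ≤ℕ 8 *ℕ (a +ℕ 2) *ℕ n ^ (3 +ℕ e) +ℕ 8 *ℕ (a +ℕ 2))
                   × _≈P_ (Algebra.ring (R n)) (Semantics.⟦_⟧ (Algebra.ring (R n)) (≡-dec _≟_ _≟_) C)
                                               (Polys.cdet (Algebra.ring (R n)) n)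
  cdet-circuit zero = circuit 0 [] (const (Algebra.1# (R 0))) , z≤n , λ
    { [] → Algebra.refl (R 0)
    ; ((() , _) ∷ _) }
  cdet-circuit (suc m) with sncSym-circuit (suc m)
  ... | C , C-size , C-sem with Simulation.simulate K (R (suc m)) m (M (suc m)) C C-sem
  ... | C′ , C′-size , C′-sem = C′ , ℕP.≤-trans C′-size (Size.polynomial a e m (size C) C-size) , C′-sem
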